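{- Let $k \ge 3$ and let $T$ be the canonical triangulation on the $2k$ distinct vertices $v_1,\dots,v_k,u_1,\dots,u_k$ (the support of a skeleton of an $r$-uniform linear $k$-cycle, $r\ge 3$). For any proper subset $U$ of $\{v_1,\dots,v_k,u_1,\dots,u_k\}$ such that $U$ contains the vertex set of at least one triangle of $T$, there exists a vertex $x \notin U$ of the support with the property that there exist $x', y, z \in U$ such that both $\{x,y,z\}$ and $\{x',y,z\}$ span triangles in $T$.
   Context: Given a skeleton $(\mathbf{e},\mathbf{v},\mathbf{u})$ of an $r$-uniform linear $k$-cycle with $\mathbf{v}=(v_1,\dots,v_k)$ the ordering of the core vertices (consecutive core vertices $v_i,v_{i+1}$ lying in edge $e_i$, indices mod $k$) and $u_i$ a non-core vertex of $e_i$, the support is the set $\{v_1,u_1,\dots,v_k,u_k\}$. The canonical triangulation of the support is the graph on the support whose edges are: $\{v_i,v_{i+1}\}$ for $1\le i\le k$ (with $v_{k+1}=v_1$); $\{u_i,v_i\}$ and $\{u_i,v_{i+1}\}$ for $1\le i\le k$; and all pairs $\{v_a,v_b\}$ with $a\neq b$ and $a+b\in\{k+1,k+2\}$ (i.e., the zigzag triangulation of the polygon $v_1v_2\cdots v_k$ with chords $v_iv_{k+1-i}$ and $v_{i+1}v_{k+1-i}$, together with a triangle $u_iv_iv_{i+1}$ attached to each side of the polygon). -}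

module Defs where

open import Data.Nat using (ℕ; zero; suc; _+_; _∸_)
open import Data.Fin using (Fin; toℕ)
open import Data.Sum using (_⊎_; inj₁; inj₂)
open import Data.Product using (_×_)
open import Data.Bool using (Bool; true; false)
open import Relation.Binary.PropositionalEquality using (_≡_; _≢_)

-- Vertices of the support {v_1,…,v_k,u_1,…,u_k}.
-- inj₁ i stands for v_{toℕ i + 1}, inj₂ i stands for u_{toℕ i + 1}
-- (0-based indices internally).  The 2k vertices are distinct by construction.
Vertex : ℕ → Set
Vertex k = Fin k ⊎ Fin k

v : ∀ {k} → Fin k → Vertex k
v = inj₁

u : ∀ {k} → Fin k → Vertex k
u = inj₂

Next : ∀ {k} → Fin k → Fin k → Set
Next {k} i j = (toℕ j ≡ suc (toℕ i)) ⊎ ((toℕ i ≡ k ∸ 1) × (toℕ j ≡ 0))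

data Gen {k : ℕ} : Vertex k → Vertex k → Set where
  cyc    : ∀ {i j} → Next i j → Gen (v i) (v j)
  uv     : ∀ i → Gen (u i) (v i)
  uvnext : ∀ {i j} → Next i j → Gen (u i) (v j)
  -- {v_a, v_b} with a ≠ b and a + b ∈ {k+1, k+2} (1-based);
  -- 0-based a = i+1, b = j+1, so (i+1)+(j+1) ≡ k+1 or k+2.
  chord  : ∀ {i j} → i ≢ j →
           ((suc (toℕ i) + suc (toℕ j) ≡ suc k) ⊎ (suc (toℕ i) + suc (toℕ j) ≡ suc (suc k))) →
           Gen (v i) (v j)

Adj : ∀ {k} → Vertex k → Vertex k → Set
Adj x y = Gen x y ⊎ Gen y x

Triangle : ∀ {k} → Vertex k → Vertex k → Vertex k → Set
Triangle x y z = Adj x y × Adj y z × Adj x z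

Subset : ℕ → Set
Subset k = Vertex k → Bool

_∈_ : ∀ {k} → Vertex k → Subset k → Set
x ∈ U = U x ≡ true

_∉_ : ∀ {k} → Vertex k → Subset k → Set
x ∉ U = U x ≡ false

-- The zigzag triangulation of
-- the core polygon is a strip: listing the core vertices in the zigzag order
-- zig = 0, K, 1, K-1, 2, … , every three consecutive entries form a triangle,
-- and every core edge joins two entries of such a window of three positions.

module Submission where

open import Defs
open import Data.Nat using (ℕ; zero; suc; _+_; _∸_; _≤_; _<_; z≤n; s≤s; s≤s⁻¹; _≟_; _≤?_)
open import Data.Nat.Properties
open import Data.Nat.DivMod using (_mod_; m<n⇒m%n≡m)
open import Data.Fin using (Fin; toℕ; fromℕ<)
import Data.Fin as Fin
import Data.Fin.Properties as Finₚ
open import Data.Sum using (_⊎_; inj₁; inj₂)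
import Data.Sum as Sum
open import Data.Product using (_×_; _,_; proj₁; proj₂; ∃-syntax)
open import Data.Bool using (Bool; true; false)
open import Data.Empty using (⊥; ⊥-elim)
open import Function using (_∘_)
open import Relation.Nullary using (yes; no)
open import Relation.Binary.PropositionalEquality
open import Relation.Binary.Definitions using (tri<; tri≈; tri>)

Exit : ∀ {k} → Subset k → Set
Exit U = ∃[ x ] (x ∉ U × ∃[ x' ] ∃[ y ] ∃[ z ]
  (x' ∈ U × y ∈ U × z ∈ U × Triangle x y z × Triangle x' y z))

adj-sym : ∀ {k} {x y : Vertex k} → Adj x y → Adj y x
adj-sym (inj₁ g) = inj₂ g
adj-sym (inj₂ g) = inj₁ g

tri-swap : ∀ {k} {x y z : Vertex k} → Triangle x y z → Triangle y x z
tri-swap (xy , yz , xz) = adj-sym xy , xz , yz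

tri-flip : ∀ {k} {x y z : Vertex k} → Triangle x y z → Triangle x z y
tri-flip (xy , yz , xz) = xz , adj-sym yz , xy

tri-rotate : ∀ {k} {x y z : Vertex k} → Triangle x y z → Triangle z x y
tri-rotate (xy , yz , xz) = adj-sym xz , xy , adj-sym yz

tri-cong : ∀ {k} {x y z x' y' z' : Vertex k} →
  x ≡ x' → y ≡ y' → z ≡ z' → Triangle x y z → Triangle x' y' z'
tri-cong refl refl refl t = t

∈-or-∉ : ∀ {k} (U : Subset k) (x : Vertex k) → x ∉ U ⊎ x ∈ U
∈-or-∉ U x with U x
... | false = inj₁ refl
... | true = inj₂ refl

u-u-nonadjacent : ∀ {k} {i j : Fin k} → Adj (u i) (u j) → ⊥
u-u-nonadjacent (inj₁ ())
u-u-nonadjacent (inj₂ ())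

CoreEdgeIn : ∀ {k} → Subset k → Set
CoreEdgeIn U = ∃[ i ] ∃[ j ] ∃[ c ]
  (Adj (v i) (v j) × Triangle c (v i) (v j) × v i ∈ U × v j ∈ U × c ∈ U)

core-edge : ∀ {k} (U : Subset k) {a b c : Vertex k} → Triangle a b c →
  a ∈ U → b ∈ U → c ∈ U → CoreEdgeIn U
core-edge U {inj₁ i} {inj₁ j} {c} (ab , bc , ac) ha hb hc =
  i , j , c , ab , tri-rotate (ab , bc , ac) , ha , hb , hc
core-edge U {inj₁ i} {inj₂ j} {inj₁ l} (ab , bc , ac) ha hb hc =
  i , l , u j , ac , tri-rotate (tri-flip (ab , bc , ac)) , ha , hc , hb
core-edge U {inj₂ i} {inj₁ j} {inj₁ l} abc@(_ , bc , _) ha hb hc =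
  j , l , u i , bc , abc , hb , hc , ha
core-edge U {inj₁ _} {inj₂ _} {inj₂ _} (_ , bc , _) _ _ _ = ⊥-elim (u-u-nonadjacent bc)
core-edge U {inj₂ _} {inj₁ _} {inj₂ _} (_ , _ , ac) _ _ _ = ⊥-elim (u-u-nonadjacent ac)
core-edge U {inj₂ _} {inj₂ _} {_}     (ab , _ , _) _ _ _ = ⊥-elim (u-u-nonadjacent ab)

Run : (ℕ → Bool) → ℕ → Set
Run f t = f t ≡ true × f (1 + t) ≡ true × f (2 + t) ≡ true

data Window (t : ℕ) : ℕ → ℕ → ℕ → Set where
  w₀₁ : Window t t (1 + t) (2 + t)
  w₁₀ : Window t (1 + t) t (2 + t)
  w₀₂ : Window t t (2 + t) (1 + t)
  w₂₀ : Window t (2 + t) t (1 + t)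
  w₁₂ : Window t (1 + t) (2 + t) t
  w₂₁ : Window t (2 + t) (1 + t) t

window-swap : ∀ {t p q r} → Window t p q r → Window t q p r
window-swap w₀₁ = w₁₀
window-swap w₁₀ = w₀₁
window-swap w₀₂ = w₂₀
window-swap w₂₀ = w₀₂
window-swap w₁₂ = w₂₁
window-swap w₂₁ = w₁₂

window-run : (f : ℕ → Bool) {t p q r : ℕ} → Window t p q r →
  f p ≡ true → f q ≡ true → f r ≡ true → Run f t
window-run f w₀₁ hp hq hr = hp , hq , hr
window-run f w₁₀ hp hq hr = hq , hp , hr
window-run f w₀₂ hp hq hr = hp , hr , hq
window-run f w₂₀ hp hq hr = hq , hr , hp
window-run f w₁₂ hp hq hr = hr , hp , hq
window-run f w₂₁ hp hq hr = hr , hq , hp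

window-third< : ∀ {n t p q r} → 2 + t < n → Window t p q r → r < n
window-third< t< w₀₁ = t<
window-third< t< w₁₀ = t<
window-third< t< w₀₂ = <-trans (n<1+n _) t<
window-third< t< w₂₀ = <-trans (n<1+n _) t<
window-third< t< w₁₂ = <-trans (m<n+m _ (s≤s z≤n)) t<
window-third< t< w₂₁ = <-trans (m<n+m _ (s≤s z≤n)) t<

data Boundary (f : ℕ → Bool) (p : ℕ) : Set where
  enters : f p ≡ false → Run f (1 + p) → Boundary f p
  leaves : Run f p → f (3 + p) ≡ false → Boundary f p

values-differ : (f : ℕ → Bool) {a q : ℕ} → f a ≡ true → f q ≡ false → a ≢ q
values-differ f fa fq refl with trans (sym fa) fq
... | ()

outside-run : (f : ℕ → Bool) {t q : ℕ} → Run f t → f q ≡ false → q < t ⊎ 3 + t ≤ q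
outside-run f {t} {q} (h₀ , h₁ , h₂) fq with <-cmp q t
... | tri< q<t _ _ = inj₁ q<t
... | tri≈ _ q≡t _ = ⊥-elim (values-differ f h₀ fq (sym q≡t))
... | tri> _ _ t<q =
  inj₂ (≤∧≢⇒< (≤∧≢⇒< t<q (values-differ f h₁ fq)) (values-differ f h₂ fq))

boundary-below : (f : ℕ → Bool) (q d : ℕ) → f q ≡ false → Run f (1 + (d + q)) →
  ∃[ p ] (p ≤ d + q × Boundary f p)
boundary-below f q d fq run with f (d + q) in fdq
boundary-below f q d fq run | false = d + q , ≤-refl , enters fdq run
boundary-below f q zero fq run | true = ⊥-elim (values-differ f fdq fq refl)
boundary-below f q (suc d) fq (h₁ , h₂ , _) | true
  with boundary-below f q d fq (fdq , h₁ , h₂)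
... | p , p≤ , b = p , m≤n⇒m≤1+n p≤ , b

boundary-above : (f : ℕ → Bool) (t d : ℕ) → Run f t → f (3 + (t + d)) ≡ false →
  ∃[ p ] (p ≤ t + d × Boundary f p)
boundary-above f t d run fq with f (3 + t) in f3
boundary-above f t d run fq | false = t , m≤m+n t d , leaves run f3
boundary-above f t zero run fq | true =
  ⊥-elim (values-differ f f3 fq (cong (3 +_) (sym (+-identityʳ t))))
boundary-above f t (suc d) (_ , h₁ , h₂) fq | true
  with boundary-above f (suc t) d (h₁ , h₂ , f3)
         (subst (λ n → f (3 + n) ≡ false) (+-suc t d) fq)
... | p , p≤ , b = p , subst (p ≤_) (sym (+-suc t d)) p≤ , b

boundary : (f : ℕ → Bool) {n t q : ℕ} → 2 + t < n → Run f t → q < n → f q ≡ false →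
  ∃[ p ] (3 + p < n × Boundary f p)
boundary f {n} {t} {q} t< run q< fq with outside-run f run fq
... | inj₁ q<t with m≤n⇒∃[o]m+o≡n q<t
...   | d , refl with boundary-below f q d fq (subst (λ m → Run f (suc m)) (+-comm q d) run)
...     | p , p≤ , b = p , ≤-trans (+-monoʳ-≤ 4 (subst (p ≤_) (+-comm d q) p≤)) t< , b
boundary f {n} {t} {q} t< run q< fq | inj₂ 3+t≤q with m≤n⇒∃[o]m+o≡n 3+t≤q
...   | d , refl with boundary-above f t d run fq
...     | p , p≤ , b = p , ≤-trans (+-monoʳ-≤ 4 p≤) q< , b

halve : ∀ t → ∃[ m ] (t ≡ m + m ⊎ t ≡ suc (m + m))
halve zero = zero , inj₁ refl
halve (suc zero) = zero , inj₂ refl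
halve (suc (suc t)) with halve t
... | m , inj₁ refl = suc m , inj₁ (cong suc (sym (+-suc m m)))
... | m , inj₂ refl = suc m , inj₂ (cong (λ n → suc (suc n)) (sym (+-suc m m)))

two-plus-double : ∀ a → a + (2 + a) ≡ 2 + (a + a)
two-plus-double a = trans (+-suc a (suc a)) (cong suc (+-suc a a))

module Zigzag (K : ℕ) (2≤K : 2 ≤ K) where

  k : ℕ
  k = suc K

  core : ℕ → Vertex k
  core n = v (n mod k)

  toℕ-mod : ∀ {n} → n < k → toℕ (n mod k) ≡ n
  toℕ-mod {n} n<k = trans (Finₚ.toℕ-fromℕ< _) (m<n⇒m%n≡m n<k)

  core-toℕ : (i : Fin k) → core (toℕ i) ≡ v i
  core-toℕ i = cong v (Finₚ.toℕ-injective (toℕ-mod (Finₚ.toℕ<n i)))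

  summands< : ∀ {i j} → i + j ≡ K → i < k × j < k
  summands< {i} {j} e =
    s≤s (subst (i ≤_) e (m≤m+n i j)) , s≤s (subst (j ≤_) e (m≤n+m j i))

  -- The core edges used by the strip triangles: sides v_i v_{i+1} and chords
  -- with label sum K or K + 1 (the closing side v_K v_0 is the chord {0, K}).
  adj-next : ∀ {i} → suc i < k → Adj (core i) (core (suc i))
  adj-next {i} lt =
    inj₁ (cyc (inj₁ (trans (toℕ-mod lt) (cong suc (sym (toℕ-mod (<-trans (n<1+n i) lt)))))))

  adj-chord : ∀ {i j} → i < k → j < k → i ≢ j → i + j ≡ K ⊎ i + j ≡ suc K →
    Adj (core i) (core j)
  adj-chord {i} {j} i<k j<k i≢j sum =
    inj₁ (chord (λ eq → i≢j (trans (sym (toℕ-mod i<k)) (trans (cong toℕ eq) (toℕ-mod j<k))))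
                (Sum.map shift shift sum))
    where
    shift : ∀ {s} → i + j ≡ s → suc (toℕ (i mod k)) + suc (toℕ (j mod k)) ≡ suc (suc s)
    shift e rewrite toℕ-mod i<k | toℕ-mod j<k = cong suc (trans (+-suc i j) (cong suc e))

  chord-triangle-low : ∀ {a b} → a + b ≡ K → suc a < b →
    Triangle (core a) (core b) (core (suc a))
  chord-triangle-low {a} {b} e sa<b =
    adj-chord a<k b<k (<⇒≢ (<-trans (n<1+n a) sa<b)) (inj₁ e) ,
    adj-chord b<k sa<k (λ eq → <⇒≢ sa<b (sym eq))
      (inj₂ (trans (+-suc b a) (cong suc (trans (+-comm b a) e)))) ,
    adj-next sa<k
    where
    a<k = proj₁ (summands< e)
    b<k = proj₂ (summands< e)
    sa<k = <-trans sa<b b<k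

  chord-triangle-high : ∀ {a b} → a + b ≡ K → a < b → 0 < a →
    Triangle (core (suc b)) (core a) (core b)
  chord-triangle-high {a} {b} e a<b 0<a =
    adj-chord sb<k a<k (λ eq → <⇒≢ (<-trans a<b (n<1+n b)) (sym eq))
      (inj₂ (cong suc (trans (+-comm b a) e))) ,
    adj-chord a<k b<k (<⇒≢ a<b) (inj₁ e) ,
    adj-sym (adj-next sb<k)
    where
    a<k = proj₁ (summands< e)
    b<k = proj₂ (summands< e)
    sb<k : suc b < k
    sb<k = s≤s (subst (b <_) (trans (+-comm b a) e) (m<m+n b 0<a))

  -- The zigzag order: zigFrom a lists a, K - a, a + 1, K - a - 1, …, so that
  -- zig (2m) = m and zig (2m + 1) = K - m.
  zigFrom : ℕ → ℕ → ℕ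
  zigFrom a zero = a
  zigFrom a (suc zero) = K ∸ a
  zigFrom a (suc (suc t)) = zigFrom (suc a) t

  zig : ℕ → ℕ
  zig = zigFrom 0

  P : ℕ → Vertex k
  P t = core (zig t)

  zigFrom-even : ∀ m a → zigFrom a (m + m) ≡ m + a
  zigFrom-even zero a = refl
  zigFrom-even (suc m) a rewrite +-suc m m = trans (zigFrom-even m (suc a)) (+-suc m a)

  zigFrom-odd : ∀ m a → zigFrom a (suc (m + m)) ≡ K ∸ (m + a)
  zigFrom-odd zero a = refl
  zigFrom-odd (suc m) a rewrite +-suc m m =
    trans (zigFrom-odd m (suc a)) (cong (K ∸_) (+-suc m a))

  complement : ∀ {a j} → a + j ≡ K → K ∸ a ≡ j
  complement {a} {j} e = trans (cong (_∸ a) (sym e)) (m+n∸m≡n a j)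

  zig-even : ∀ m → zig (m + m) ≡ m
  zig-even m = trans (zigFrom-even m 0) (+-identityʳ m)

  zig-even₂ : ∀ m → zig (2 + (m + m)) ≡ suc m
  zig-even₂ m = trans (zigFrom-even m 1) (+-comm m 1)

  zig-odd : ∀ m {j} → m + j ≡ K → zig (1 + (m + m)) ≡ j
  zig-odd m {j} e =
    trans (zigFrom-odd m 0) (complement (trans (cong (_+ j) (+-identityʳ m)) e))

  zig-odd₂ : ∀ m {j} → suc m + j ≡ K → zig (3 + (m + m)) ≡ j
  zig-odd₂ m {j} e =
    trans (zigFrom-odd m 1) (complement (trans (cong (_+ j) (+-comm m 1)) e))

  even-window< : ∀ {a b} → a + b ≡ K → suc a < b → 2 + (a + a) < k
  even-window< {a} e sa<b = s≤s (subst₂ _≤_ (two-plus-double a) e (+-monoʳ-≤ a sa<b))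

  even-window> : ∀ {a b} → a + b ≡ K → 2 + (a + a) < k → suc a < b
  even-window> {a} {b} e t< =
    +-cancelˡ-≤ a (2 + a) b (subst₂ _≤_ (sym (two-plus-double a)) (sym e) (s≤s⁻¹ t<))

  odd-window< : ∀ {m b} → suc m + b ≡ K → suc m < b → 3 + (m + m) < k
  odd-window< {m} e sm<b =
    s≤s (subst₂ _≤_ (cong suc (two-plus-double m)) e (+-monoʳ-≤ (suc m) sm<b))

  odd-window> : ∀ {m b} → suc m + b ≡ K → 3 + (m + m) < k → suc m < b
  odd-window> {m} {b} e t< =
    +-cancelˡ-≤ (suc m) (2 + m) b
      (subst₂ _≤_ (sym (cong suc (two-plus-double m))) (sym e) (s≤s⁻¹ t<))

  relabel : ∀ p q r {a b c} → zig p ≡ a → zig q ≡ b → zig r ≡ c →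
    Triangle (core a) (core b) (core c) → Triangle (P p) (P q) (P r)
  relabel p q r zp zq zr = tri-cong (cong core (sym zp)) (cong core (sym zq)) (cong core (sym zr))

  -- Every triple of consecutive positions spans a triangle of T: at an even
  -- position 2m the chord {m, K - m} with third vertex m + 1, at an odd
  -- position 2m + 1 the chord {m + 1, K - m - 1} with third vertex K - m.
  strip-even : ∀ m → 2 + (m + m) < k → Triangle (P (m + m)) (P (1 + (m + m))) (P (2 + (m + m)))
  strip-even m t< with m≤n⇒∃[o]m+o≡n m≤K
    where m≤K : m ≤ K
          m≤K = ≤-trans (m≤m+n m m) (≤-trans (m≤n+m (m + m) 2) (s≤s⁻¹ t<))
  ... | b , e = relabel (m + m) (1 + (m + m)) (2 + (m + m))
                  (zig-even m) (zig-odd m e) (zig-even₂ m)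
                  (chord-triangle-low e (even-window> e t<))

  strip-odd : ∀ m → 3 + (m + m) < k → Triangle (P (1 + (m + m))) (P (2 + (m + m))) (P (3 + (m + m)))
  strip-odd m t< with m≤n⇒∃[o]m+o≡n sm≤K
    where sm≤K : suc m ≤ K
          sm≤K = ≤-trans (s≤s (m≤m+n m m)) (≤-trans (m≤n+m (suc (m + m)) 2) (s≤s⁻¹ t<))
  ... | b , e = relabel (1 + (m + m)) (2 + (m + m)) (3 + (m + m))
                  (zig-odd m (trans (+-suc m b) e)) (zig-even₂ m) (zig-odd₂ m e)
                  (chord-triangle-high e (odd-window> e t<) (s≤s z≤n))

  strip : ∀ t → 2 + t < k → Triangle (P t) (P (1 + t)) (P (2 + t))
  strip t t< with halve t
  ... | m , inj₁ refl = strip-even m t<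
  ... | m , inj₂ refl = strip-odd m t<

  zig-onto : ∀ {i} → i ≤ K → ∃[ q ] (q < k × zig q ≡ i)
  zig-onto {i} i≤K with m≤n⇒∃[o]m+o≡n i≤K
  ... | b , e with i ≤? b
  ...   | yes i≤b = i + i , s≤s (≤-trans (+-monoʳ-≤ i i≤b) (≤-reflexive e)) , zig-even i
  ...   | no i≰b =
    suc (b + b) , s≤s (subst (b + b <_) e' (+-monoʳ-< b (≰⇒> i≰b))) , zig-odd b e'
    where e' : b + i ≡ K
          e' = trans (+-comm b i) e

  position : (i : Fin k) → ∃[ q ] (q < k × P q ≡ v i)
  position i with zig-onto (s≤s⁻¹ (Finₚ.toℕ<n i))
  ... | q , q< , zq = q , q< , trans (cong core zq) (core-toℕ i)

  window-triangle : ∀ {t p q r} → 2 + t < k → Window t p q r → Triangle (P r) (P p) (P q)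
  window-triangle {t} t< w₀₁ = tri-rotate (strip t t<)
  window-triangle {t} t< w₁₀ = tri-flip (tri-rotate (strip t t<))
  window-triangle {t} t< w₀₂ = tri-swap (strip t t<)
  window-triangle {t} t< w₂₀ = tri-flip (tri-swap (strip t t<))
  window-triangle {t} t< w₁₂ = strip t t<
  window-triangle {t} t< w₂₁ = tri-flip (strip t t<)

  record Covering (i j : ℕ) : Set where
    constructor covering
    field
      t p q r : ℕ
      window< : 2 + t < k
      window : Window t p q r
      zig-p : zig p ≡ i
      zig-q : zig q ≡ j

  covering-sym : ∀ {i j} → Covering i j → Covering j i
  covering-sym (covering t p q r t< w zp zq) = covering t q p r t< (window-swap w) zq zp

  covering-chord : ∀ {i j} → i < j → i + j ≡ K → Covering i j
  covering-chord {i} i<j e with m≤n⇒m<n∨m≡n i<j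
  ... | inj₁ si<j =
    covering (i + i) (i + i) (1 + (i + i)) (2 + (i + i))
      (even-window< e si<j) w₀₁ (zig-even i) (zig-odd i e)
  covering-chord {zero} i<j e | inj₂ refl = ⊥-elim (1+n≰n (subst (2 ≤_) (sym e) 2≤K))
  covering-chord {suc m} i<j e | inj₂ refl =
    covering (1 + (m + m)) (2 + (m + m)) (3 + (m + m)) (1 + (m + m))
      (odd-window< e (n<1+n (suc m))) w₁₂ (zig-even₂ m) (zig-odd₂ m e)

  covering-chord⁺ : ∀ {i j} → i < j → j < k → i + j ≡ suc K → Covering i j
  covering-chord⁺ {zero} i<j j<k e = ⊥-elim (<-irrefl e j<k)
  covering-chord⁺ {suc m} i<j j<k e =
    covering (m + m) (2 + (m + m)) (1 + (m + m)) (m + m)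
      (even-window< e' i<j) w₂₁ (zig-even₂ m) (zig-odd m e')
    where e' = suc-injective e

  covering-chord-any : ∀ {i j} → i < k → j < k → i ≢ j → i + j ≡ K ⊎ i + j ≡ suc K → Covering i j
  covering-chord-any {i} {j} i<k j<k i≢j sum with <-cmp i j
  ... | tri< i<j _ _ = Sum.[ covering-chord i<j , covering-chord⁺ i<j j<k ] sum
  ... | tri≈ _ i≡j _ = ⊥-elim (i≢j i≡j)
  ... | tri> _ _ j<i = covering-sym
          (Sum.[ covering-chord j<i ∘ trans (+-comm j i)
               , covering-chord⁺ j<i i<k ∘ trans (+-comm j i) ] sum)

  covering-side : ∀ i b → suc i < k → i + b ≡ K → Covering i (suc i)
  covering-side i b lt e with <-cmp (suc i) b
  ... | tri< si<b _ _ =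
    covering (i + i) (i + i) (2 + (i + i)) (1 + (i + i))
      (even-window< e si<b) w₀₂ (zig-even i) (zig-even₂ i)
  ... | tri≈ _ refl _ = covering-chord (n<1+n i) e
  ... | tri> _ _ b<si with m≤n⇒m<n∨m≡n (s≤s⁻¹ b<si)
  ...   | inj₂ refl = covering-chord⁺ (n<1+n i) lt (trans (+-suc i i) (cong suc e))
  covering-side i zero lt e | tri> _ _ _ | inj₁ _ =
    ⊥-elim (<-irrefl (trans (sym (+-identityʳ i)) e) (s≤s⁻¹ lt))
  covering-side i (suc m) lt e | tri> _ _ _ | inj₁ b<i =
    covering (1 + (m + m)) (3 + (m + m)) (1 + (m + m)) (2 + (m + m))
      (odd-window< e' b<i) w₂₀ (zig-odd₂ m e') (zig-odd m (trans (+-suc m i) e'))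
    where e' = trans (+-comm (suc m) i) e

  covering-next : ∀ {i} → suc i < k → Covering i (suc i)
  covering-next {i} lt with m≤n⇒∃[o]m+o≡n (<⇒≤ (s≤s⁻¹ lt))
  ... | b , e = covering-side i b lt e

  covering-wrap : Covering K 0
  covering-wrap = covering 0 1 0 2 (s≤s 2≤K) w₁₀ refl refl

  gen-covering : ∀ {a b : Fin k} → Gen (v a) (v b) → Covering (toℕ a) (toℕ b)
  gen-covering {a} {b} (cyc (inj₁ e)) =
    subst (Covering (toℕ a)) (sym e) (covering-next (subst (_< k) e (Finₚ.toℕ<n b)))
  gen-covering (cyc (inj₂ (a≡K , b≡0))) = subst₂ Covering (sym a≡K) (sym b≡0) covering-wrap
  gen-covering {a} {b} (chord a≢b sum) =
    covering-chord-any (Finₚ.toℕ<n a) (Finₚ.toℕ<n b) (a≢b ∘ Finₚ.toℕ-injective)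
      (Sum.map unshift unshift sum)
    where unshift : ∀ {x y s} → suc x + suc y ≡ suc (suc s) → x + y ≡ s
          unshift {x} {y} e = suc-injective (trans (sym (+-suc x y)) (suc-injective e))

  edge-covering : (a b : Fin k) → Adj (v a) (v b) → Covering (toℕ a) (toℕ b)
  edge-covering a b (inj₁ g) = gen-covering g
  edge-covering a b (inj₂ g) = covering-sym (gen-covering g)

  membership : Subset k → ℕ → Bool
  membership U q = U (P q)

  through-edge : (U : Subset k) (a b : Fin k) → Adj (v a) (v b) →
    ∃[ t ] ∃[ r ] (2 + t < k × r < k × Triangle (P r) (v a) (v b) ×
                   (v a ∈ U → v b ∈ U → P r ∈ U → Run (membership U) t))
  through-edge U a b ab with edge-covering a b ab
  ... | covering t p q r t< w zp zq =
    t , r , t< , window-third< t< w , tri-cong refl Pp Pq (window-triangle t< w) ,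
    λ ha hb hr → window-run (membership U) w (subst (λ x → U x ≡ true) (sym Pp) ha)
                                            (subst (λ x → U x ≡ true) (sym Pq) hb) hr
    where Pp : P p ≡ v a
          Pp = trans (cong core zp) (core-toℕ a)
          Pq : P q ≡ v b
          Pq = trans (cong core zq) (core-toℕ b)

  seed : (U : Subset k) → ∃[ a ] ∃[ b ] ∃[ c ] (Triangle a b c × a ∈ U × b ∈ U × c ∈ U) →
    Exit U ⊎ ∃[ t ] (2 + t < k × Run (membership U) t)
  seed U (_ , _ , _ , abc , ha , hb , hc) with core-edge U abc ha hb hc
  ... | i , j , c , ij , cij , hi , hj , hc' with through-edge U i j ij
  ...   | t , r , t< , _ , rij , run with ∈-or-∉ U (P r)
  ...     | inj₁ r∉U = inj₁ (P r , r∉U , c , v i , v j , hc' , hi , hj , rij , cij)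
  ...     | inj₂ r∈U = inj₂ (t , t< , run hi hj r∈U)

  next-index : (i : Fin k) → ∃[ j ] Next i j
  next-index i with toℕ i ≟ K
  ... | yes i≡K = Fin.zero , inj₂ (i≡K , refl)
  ... | no i≢K = fromℕ< lt , inj₁ (Finₚ.toℕ-fromℕ< lt)
    where lt : suc (toℕ i) < k
          lt = s≤s (≤∧≢⇒< (s≤s⁻¹ (Finₚ.toℕ<n i)) i≢K)

  missing-position : (U : Subset k) (i : Fin k) → v i ∉ U → ∃[ q ] (q < k × P q ∉ U)
  missing-position U i out with position i
  ... | q , q< , Pq = q , q< , subst (λ x → U x ≡ false) (sym Pq) out

  -- For an ear vertex u_i with v_i, v_{i+1} ∈ U, the ear u_i v_i v_{i+1} and the
  -- strip triangle on the side v_i v_{i+1} give the conclusion.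
  gap : (U : Subset k) (w : Vertex k) → w ∉ U → Exit U ⊎ ∃[ q ] (q < k × P q ∉ U)
  gap U (inj₁ i) out = inj₂ (missing-position U i out)
  gap U (inj₂ i) out with next-index i
  ... | j , i→j with ∈-or-∉ U (v i) | ∈-or-∉ U (v j)
  ...   | inj₁ i∉U | _ = inj₂ (missing-position U i i∉U)
  ...   | inj₂ _ | inj₁ j∉U = inj₂ (missing-position U j j∉U)
  ...   | inj₂ i∈U | inj₂ j∈U with through-edge U i j (inj₁ (cyc i→j))
  ...     | _ , r , _ , r< , rij , _ with ∈-or-∉ U (P r)
  ...       | inj₁ r∉U = inj₂ (r , r< , r∉U)
  ...       | inj₂ r∈U = inj₁ (u i , out , P r , v i , v j , r∈U , i∈U , j∈U , ear , rij)
    where ear : Triangle (u i) (v i) (v j)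
          ear = inj₁ (uv i) , inj₁ (cyc i→j) , inj₁ (uvnext i→j)

  -- Two consecutive strip triangles sharing an edge, at a boundary of U.
  exit-at-boundary : (U : Subset k) {p : ℕ} → 3 + p < k → Boundary (membership U) p → Exit U
  exit-at-boundary U {p} p< (enters out (h₁ , h₂ , h₃)) =
    P p , out , P (3 + p) , P (1 + p) , P (2 + p) , h₃ , h₁ , h₂ ,
    strip p (<-trans (n<1+n _) p<) , tri-rotate (strip (1 + p) p<)
  exit-at-boundary U {p} p< (leaves (h₀ , h₁ , h₂) out) =
    P (3 + p) , out , P p , P (1 + p) , P (2 + p) , h₀ , h₁ , h₂ ,
    tri-rotate (strip (1 + p) p<) , strip p (<-trans (n<1+n _) p<)

  exit-from-gap : (U : Subset k) {t q : ℕ} → 2 + t < k → Run (membership U) t →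
    q < k → P q ∉ U → Exit U
  exit-from-gap U t< run q< out with boundary (membership U) t< run q< out
  ... | p , p< , b = exit-at-boundary U p< b

proposition2p3 : (k : ℕ) → 3 ≤ k → (U : Subset k) →
    (∃[ w ] (w ∉ U)) →
    (∃[ a ] ∃[ b ] ∃[ c ] (Triangle a b c × a ∈ U × b ∈ U × c ∈ U)) →
    ∃[ x ] (x ∉ U × ∃[ x' ] ∃[ y ] ∃[ z ]
      (x' ∈ U × y ∈ U × z ∈ U × Triangle x y z × Triangle x' y z))
proposition2p3 (suc K) (s≤s 2≤K) U (w , w∉U) inside = conclude (seed U inside) (gap U w w∉U)
  where
  -- Seed and gap each either finish, or provide a run of U and a strip
  -- position outside U, which meet at a boundary.
  open Zigzag K 2≤K
  conclude : Exit U ⊎ ∃[ t ] (2 + t < k × Run (membership U) t) →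
             Exit U ⊎ ∃[ q ] (q < k × P q ∉ U) → Exit U
  conclude (inj₁ exit) _ = exit
  conclude (inj₂ _) (inj₁ exit) = exit
  conclude (inj₂ (t , t< , run)) (inj₂ (q , q< , out)) = exit-from-gap U t< run q< out
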